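{- If $m$ and $n$ are non-negative integers, then \[ \sum_{k = 1}^n \sum_{j = 0}^{k - 1} \frac{\left( n - j \right)!}{k - j}\binom{n}{j}\left\{ m \atop n - j \right\} = n^m H_n - \sum_{k = 1}^n \frac{\left( n - k \right)^m }{k} . \]
   Context: $\left\{ m \atop p\right\}$ denotes the Stirling number of the second kind; $H_n=\sum_{i=1}^n\frac1i$; the convention $0^0=1$ is used. Empty sums are $0$. -}

module Defs where

open import Data.Nat using (ℕ; zero; suc; _+_; _*_; _∸_; _^_)
open import Data.Integer using (+_)
open import Data.Rational using (ℚ; 0ℚ; _/_) renaming (_+_ to _+ℚ_)

stirling₂ : ℕ → ℕ → ℕ
stirling₂ zero    zero    = 1
stirling₂ zero    (suc p) = 0
stirling₂ (suc m) zero    = 0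
stirling₂ (suc m) (suc p) = suc p * stirling₂ m (suc p) + stirling₂ m p

sumℚ : ℕ → (ℕ → ℚ) → ℚ
sumℚ zero    f = 0ℚ
sumℚ (suc n) f = sumℚ n f +ℚ f n

_⁄suc_ : ℕ → ℕ → ℚ
a ⁄suc b = (+ a) / suc b

H : ℕ → ℚ
H n = sumℚ n (λ i → 1 ⁄suc i)

-- Both sides equal ∑_{p=0}^{n} S(m,p) n^{\underline p} H_p.  On the left,
-- (n-j)! C(n,j) is the falling factorial n^{\underline{n-j}}, and summing the
-- triangular double sum along its diagonals turns each inner sum into H_{n-j}.
-- On the right, expand x^m = ∑_p S(m,p) x^{\underline p} in both terms; what
-- remains is  n^{\underline p} (H_n - H_p) = ∑_{k=1}^{n} (n-k)^{\underline p} / k,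
-- which follows by induction from the Pascal-type rule
-- (x+1)^{\underline{p+1}} = x^{\underline{p+1}} + (p+1) x^{\underline p}.

{-# OPTIONS --safe #-}
module Submission where

open import Defs
open import Data.Nat using (ℕ; zero; suc; _+_; _*_; _∸_; _^_)
open import Data.Nat using (_!)
open import Data.Nat.Combinatorics using (_C_)
open import Data.Integer using (+_)
open import Data.Rational using (ℚ; _/_) renaming (_*_ to _*ℚ_; _-_ to _-ℚ_)
open import Relation.Binary.PropositionalEquality using (_≡_)

open import Algebra.Bundles using (CommutativeMonoid)
open import Data.Nat using (_<_; _≤_; s≤s)
open import Data.Nat.Combinatorics using (nCk+nC[k+1]≡[n+1]C[k+1]; nCk≡nC[n∸k])
import Data.Nat.Properties as ℕ
open import Data.Nat.Tactic.RingSolver using (solve-∀)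
import Data.Integer as ℤ
import Data.Integer.Properties as ℤ
open import Data.Rational using (0ℚ; 1ℚ; fromℚᵘ; toℚᵘ) renaming (_+_ to _+ℚ_)
import Data.Rational.Properties as ℚ
open import Data.Rational.Solver using (module +-*-Solver)
open import Data.Rational.Unnormalised as ℚᵘ using (ℚᵘ; mkℚᵘ; *≡*)
import Data.Rational.Unnormalised.Properties as ℚᵘ
open import Function using (_∘_)
open import Relation.Binary.PropositionalEquality using (refl; sym; trans; cong; cong₂; module ≡-Reasoning)

open import Algebra.Properties.CommutativeSemigroup
  (CommutativeMonoid.commutativeSemigroup ℚ.+-0-commutativeMonoid) using (interchange)
open import Algebra.Properties.Group ℚ.+-0-group using (//-rightDividesʳ)

fromℚᵘ-homo-+ : ∀ x y → fromℚᵘ (x ℚᵘ.+ y) ≡ fromℚᵘ x +ℚ fromℚᵘ y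
fromℚᵘ-homo-+ x y = ℚ.toℚᵘ-injective (begin
  toℚᵘ (fromℚᵘ (x ℚᵘ.+ y))             ≈⟨ ℚ.toℚᵘ-fromℚᵘ (x ℚᵘ.+ y) ⟩
  x ℚᵘ.+ y                             ≈⟨ ℚᵘ.+-cong (ℚᵘ.≃-sym (ℚ.toℚᵘ-fromℚᵘ x)) (ℚᵘ.≃-sym (ℚ.toℚᵘ-fromℚᵘ y)) ⟩
  toℚᵘ (fromℚᵘ x) ℚᵘ.+ toℚᵘ (fromℚᵘ y) ≈⟨ ℚᵘ.≃-sym (ℚ.toℚᵘ-homo-+ (fromℚᵘ x) (fromℚᵘ y)) ⟩
  toℚᵘ (fromℚᵘ x +ℚ fromℚᵘ y)          ∎)
  where open ℚᵘ.≃-Reasoning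

fromℚᵘ-homo-* : ∀ x y → fromℚᵘ (x ℚᵘ.* y) ≡ fromℚᵘ x *ℚ fromℚᵘ y
fromℚᵘ-homo-* x y = ℚ.toℚᵘ-injective (begin
  toℚᵘ (fromℚᵘ (x ℚᵘ.* y))             ≈⟨ ℚ.toℚᵘ-fromℚᵘ (x ℚᵘ.* y) ⟩
  x ℚᵘ.* y                             ≈⟨ ℚᵘ.*-cong (ℚᵘ.≃-sym (ℚ.toℚᵘ-fromℚᵘ x)) (ℚᵘ.≃-sym (ℚ.toℚᵘ-fromℚᵘ y)) ⟩
  toℚᵘ (fromℚᵘ x) ℚᵘ.* toℚᵘ (fromℚᵘ y) ≈⟨ ℚᵘ.≃-sym (ℚ.toℚᵘ-homo-* (fromℚᵘ x) (fromℚᵘ y)) ⟩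
  toℚᵘ (fromℚᵘ x *ℚ fromℚᵘ y)          ∎)
  where open ℚᵘ.≃-Reasoning

fromℕ : ℕ → ℚ
fromℕ a = + a / 1

private
  ι : ℕ → ℚᵘ
  ι a = mkℚᵘ (+ a) 0

fromℕ-homo-+ : ∀ a b → fromℕ (a + b) ≡ fromℕ a +ℚ fromℕ b
fromℕ-homo-+ a b =
  trans (ℚ.fromℚᵘ-cong {ι (a + b)} {ι a ℚᵘ.+ ι b} (*≡* (cong (ℤ._* ℤ.1ℤ) +[a+b]≡+a*1+b*1)))
        (fromℚᵘ-homo-+ (ι a) (ι b))
  where
  +[a+b]≡+a*1+b*1 : + (a + b) ≡ + a ℤ.* ℤ.1ℤ ℤ.+ + b ℤ.* ℤ.1ℤ
  +[a+b]≡+a*1+b*1 = trans (ℤ.pos-+ a b) (sym (cong₂ ℤ._+_ (ℤ.*-identityʳ (+ a)) (ℤ.*-identityʳ (+ b))))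

fromℕ-homo-* : ∀ a b → fromℕ (a * b) ≡ fromℕ a *ℚ fromℕ b
fromℕ-homo-* a b =
  trans (ℚ.fromℚᵘ-cong {ι (a * b)} {ι a ℚᵘ.* ι b} (*≡* (cong (ℤ._* ℤ.1ℤ) (ℤ.pos-* a b))))
        (fromℚᵘ-homo-* (ι a) (ι b))

a⁄suc-b≡a*1⁄suc-b : ∀ a b → a ⁄suc b ≡ fromℕ a *ℚ 1 ⁄suc b
a⁄suc-b≡a*1⁄suc-b a b =
  trans (ℚ.fromℚᵘ-cong {mkℚᵘ (+ a) b} {ι a ℚᵘ.* mkℚᵘ (+ 1) b} (*≡* +a*[1+b+0]≡+a*1*[1+b]))
        (fromℚᵘ-homo-* (ι a) (mkℚᵘ (+ 1) b))
  where
  +a*[1+b+0]≡+a*1*[1+b] : + a ℤ.* + suc (b + 0) ≡ + a ℤ.* ℤ.1ℤ ℤ.* + suc b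
  +a*[1+b+0]≡+a*1*[1+b] = cong₂ ℤ._*_ (sym (ℤ.*-identityʳ (+ a))) (cong (+_ ∘ suc) (ℕ.+-identityʳ b))

[1+b]*1⁄suc-b≡1 : ∀ b → fromℕ (suc b) *ℚ 1 ⁄suc b ≡ 1ℚ
[1+b]*1⁄suc-b≡1 b =
  trans (sym (fromℚᵘ-homo-* (ι (suc b)) (mkℚᵘ (+ 1) b)))
        (ℚ.fromℚᵘ-cong {ι (suc b) ℚᵘ.* mkℚᵘ (+ 1) b} {ι 1} (*≡* [1+b]*1*1≡1*[1+b+0]))
  where
  [1+b]*1*1≡1*[1+b+0] : + suc b ℤ.* ℤ.1ℤ ℤ.* ℤ.1ℤ ≡ ℤ.1ℤ ℤ.* + suc (b + 0)
  [1+b]*1*1≡1*[1+b+0] = trans (ℤ.*-identityʳ _) (trans (ℤ.*-identityʳ _)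
    (sym (trans (ℤ.*-identityˡ _) (cong (+_ ∘ suc) (ℕ.+-identityʳ b)))))

[1+b]*x*1⁄suc-b≡x : ∀ b x → fromℕ (suc b) *ℚ x *ℚ 1 ⁄suc b ≡ x
[1+b]*x*1⁄suc-b≡x b x = begin
  fromℕ (suc b) *ℚ x *ℚ 1 ⁄suc b    ≡⟨ rearrange (fromℕ (suc b)) x (1 ⁄suc b) ⟩
  x *ℚ (fromℕ (suc b) *ℚ 1 ⁄suc b)  ≡⟨ cong (x *ℚ_) ([1+b]*1⁄suc-b≡1 b) ⟩
  x *ℚ 1ℚ                           ≡⟨ ℚ.*-identityʳ x ⟩
  x                                 ∎
  where
  open ≡-Reasoning
  rearrange : ∀ a y w → a *ℚ y *ℚ w ≡ y *ℚ (a *ℚ w)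
  rearrange = +-*-Solver.solve 3 (λ a y w → a :* y :* w := y :* (a :* w)) refl
    where open +-*-Solver

sumℚ-cong< : ∀ n {f g : ℕ → ℚ} → (∀ i → i < n → f i ≡ g i) → sumℚ n f ≡ sumℚ n g
sumℚ-cong< zero    f≡g = refl
sumℚ-cong< (suc n) f≡g = cong₂ _+ℚ_ (sumℚ-cong< n (λ i i<n → f≡g i (ℕ.m<n⇒m<1+n i<n))) (f≡g n (ℕ.n<1+n n))

sumℚ-cong : ∀ n {f g : ℕ → ℚ} → (∀ i → f i ≡ g i) → sumℚ n f ≡ sumℚ n g
sumℚ-cong n f≡g = sumℚ-cong< n (λ i _ → f≡g i)

sumℚ-zero : ∀ n → sumℚ n (λ _ → 0ℚ) ≡ 0ℚ
sumℚ-zero zero    = refl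
sumℚ-zero (suc n) = trans (ℚ.+-identityʳ _) (sumℚ-zero n)

sumℚ-distrib-+ : ∀ n (f g : ℕ → ℚ) → sumℚ n (λ i → f i +ℚ g i) ≡ sumℚ n f +ℚ sumℚ n g
sumℚ-distrib-+ zero    f g = refl
sumℚ-distrib-+ (suc n) f g =
  trans (cong (_+ℚ (f n +ℚ g n)) (sumℚ-distrib-+ n f g)) (interchange (sumℚ n f) (sumℚ n g) (f n) (g n))

sumℚ-distribˡ-* : ∀ n c (f : ℕ → ℚ) → c *ℚ sumℚ n f ≡ sumℚ n (λ i → c *ℚ f i)
sumℚ-distribˡ-* zero    c f = ℚ.*-zeroʳ c
sumℚ-distribˡ-* (suc n) c f =
  trans (ℚ.*-distribˡ-+ c (sumℚ n f) (f n)) (cong (_+ℚ c *ℚ f n) (sumℚ-distribˡ-* n c f))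

sumℚ-distribʳ-* : ∀ n c (f : ℕ → ℚ) → sumℚ n f *ℚ c ≡ sumℚ n (λ i → f i *ℚ c)
sumℚ-distribʳ-* zero    c f = ℚ.*-zeroˡ c
sumℚ-distribʳ-* (suc n) c f =
  trans (ℚ.*-distribʳ-+ c (sumℚ n f) (f n)) (cong (_+ℚ f n *ℚ c) (sumℚ-distribʳ-* n c f))

sumℚ-head : ∀ n (f : ℕ → ℚ) → sumℚ (suc n) f ≡ f 0 +ℚ sumℚ n (f ∘ suc)
sumℚ-head zero    f = ℚ.+-comm 0ℚ (f 0)
sumℚ-head (suc n) f = trans (cong (_+ℚ f (suc n)) (sumℚ-head n f)) (ℚ.+-assoc (f 0) _ _)

sumℚ-init : ∀ n {f : ℕ → ℚ} → f n ≡ 0ℚ → sumℚ (suc n) f ≡ sumℚ n f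
sumℚ-init n {f} fn≡0 = trans (cong (sumℚ n f +ℚ_) fn≡0) (ℚ.+-identityʳ (sumℚ n f))

sumℚ-tail : ∀ n {f : ℕ → ℚ} → f 0 ≡ 0ℚ → sumℚ (suc n) f ≡ sumℚ n (f ∘ suc)
sumℚ-tail n {f} f0≡0 = trans (sumℚ-head n f) (trans (cong (_+ℚ sumℚ n (f ∘ suc)) f0≡0) (ℚ.+-identityˡ _))

sumℚ-comm : ∀ a b (f : ℕ → ℕ → ℚ) →
  sumℚ a (λ i → sumℚ b (f i)) ≡ sumℚ b (λ j → sumℚ a (λ i → f i j))
sumℚ-comm zero    b f = sym (sumℚ-zero b)
sumℚ-comm (suc a) b f = trans (cong (_+ℚ sumℚ b (f a)) (sumℚ-comm a b f))
  (sym (sumℚ-distrib-+ b (λ j → sumℚ a (λ i → f i j)) (f a)))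

sumℚ-reverse : ∀ n (f : ℕ → ℚ) → sumℚ n (λ j → f (n ∸ j)) ≡ sumℚ n (f ∘ suc)
sumℚ-reverse zero    f = refl
sumℚ-reverse (suc n) f = begin
  sumℚ (suc n) (λ j → f (suc n ∸ j))       ≡⟨ sumℚ-head n (λ j → f (suc n ∸ j)) ⟩
  f (suc n) +ℚ sumℚ n (λ j → f (n ∸ j))    ≡⟨ cong (f (suc n) +ℚ_) (sumℚ-reverse n f) ⟩
  f (suc n) +ℚ sumℚ n (f ∘ suc)            ≡⟨ ℚ.+-comm (f (suc n)) _ ⟩
  sumℚ (suc n) (f ∘ suc)                   ∎
  where open ≡-Reasoning

sumℚ-triangle : ∀ n (g : ℕ → ℕ → ℚ) →
  sumℚ n (λ i → sumℚ (suc i) (λ j → g j (i ∸ j))) ≡ sumℚ n (λ j → sumℚ (n ∸ j) (g j))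
sumℚ-triangle zero    g = refl
sumℚ-triangle (suc n) g = begin
  sumℚ n (λ i → sumℚ (suc i) (λ j → g j (i ∸ j))) +ℚ diagonal
    ≡⟨ cong (_+ℚ diagonal) (sumℚ-triangle n g) ⟩
  sumℚ n (λ j → sumℚ (n ∸ j) (g j)) +ℚ diagonal
    ≡⟨ cong (_+ℚ diagonal) (sumℚ-init n (cong (λ k → sumℚ k (g n)) (ℕ.n∸n≡0 n))) ⟨
  sumℚ (suc n) (λ j → sumℚ (n ∸ j) (g j)) +ℚ diagonal
    ≡⟨ sumℚ-distrib-+ (suc n) (λ j → sumℚ (n ∸ j) (g j)) (λ j → g j (n ∸ j)) ⟨
  sumℚ (suc n) (λ j → sumℚ (n ∸ j) (g j) +ℚ g j (n ∸ j))
    ≡⟨ sumℚ-cong< (suc n) (λ j j≤n → cong (λ k → sumℚ k (g j)) (sym (ℕ.+-∸-assoc 1 (ℕ.<⇒≤pred j≤n)))) ⟩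
  sumℚ (suc n) (λ j → sumℚ (suc n ∸ j) (g j)) ∎
  where
  open ≡-Reasoning
  diagonal : ℚ
  diagonal = sumℚ (suc n) (λ j → g j (n ∸ j))

infixr 8 _^↓_

_^↓_ : ℕ → ℕ → ℕ
x     ^↓ zero  = 1
zero  ^↓ suc p = 0
suc x ^↓ suc p = suc x * x ^↓ p

^↓-pascal : ∀ x p → suc x ^↓ suc p ≡ x ^↓ suc p + suc p * x ^↓ p
x*x^↓p≡x^↓[1+p]+p*x^↓p : ∀ x p → x * x ^↓ p ≡ x ^↓ suc p + p * x ^↓ p

^↓-pascal x p =
  trans (cong (_+_ (x ^↓ p)) (x*x^↓p≡x^↓[1+p]+p*x^↓p x p)) (rearrange (x ^↓ p) (x ^↓ suc p) (p * x ^↓ p))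
  where
  rearrange : ∀ a b c → a + (b + c) ≡ b + (a + c)
  rearrange = solve-∀

x*x^↓p≡x^↓[1+p]+p*x^↓p zero    zero    = refl
x*x^↓p≡x^↓[1+p]+p*x^↓p zero    (suc p) = sym (ℕ.*-zeroʳ (suc p))
x*x^↓p≡x^↓[1+p]+p*x^↓p (suc x) zero    = sym (ℕ.+-identityʳ (suc x * 1))
x*x^↓p≡x^↓[1+p]+p*x^↓p (suc x) (suc p) =
  trans (cong (suc x *_) (^↓-pascal x p)) (distrib (suc x) (x ^↓ suc p) (suc p) (x ^↓ p))
  where
  distrib : ∀ a b c d → a * (b + c * d) ≡ a * b + c * (a * d)
  distrib = solve-∀

^↓-vanishes : ∀ {x p} → x < p → x ^↓ p ≡ 0
^↓-vanishes {zero}  {suc p} _         = refl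
^↓-vanishes {suc x} {suc p} (s≤s x<p) = trans (cong (suc x *_) (^↓-vanishes x<p)) (ℕ.*-zeroʳ (suc x))

p!*nCp≡n^↓p : ∀ n p → p ! * (n C p) ≡ n ^↓ p
p!*nCp≡n^↓p zero    zero    = refl
p!*nCp≡n^↓p zero    (suc p) = ℕ.*-zeroʳ (suc p !)
p!*nCp≡n^↓p (suc n) zero    = refl
p!*nCp≡n^↓p (suc n) (suc p) = begin
  suc p ! * (suc n C suc p)                        ≡⟨ cong (suc p ! *_) (nCk+nC[k+1]≡[n+1]C[k+1] n p) ⟨
  suc p * p ! * (n C p + n C suc p)                ≡⟨ distrib (suc p) (p !) (n C p) (n C suc p) ⟩
  suc p ! * (n C suc p) + suc p * (p ! * (n C p))  ≡⟨ cong₂ (λ a b → a + suc p * b) (p!*nCp≡n^↓p n (suc p)) (p!*nCp≡n^↓p n p) ⟩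
  n ^↓ suc p + suc p * n ^↓ p                      ≡⟨ ^↓-pascal n p ⟨
  suc n ^↓ suc p                                   ∎
  where
  open ≡-Reasoning
  distrib : ∀ a b c d → a * b * (c + d) ≡ a * b * d + a * (b * c)
  distrib = solve-∀

stirling₂-step : ∀ m x p →
  x * (stirling₂ m p * x ^↓ p) ≡ stirling₂ m p * x ^↓ suc p + p * (stirling₂ m p * x ^↓ p)
stirling₂-step m x p = begin
  x * (s * x ^↓ p)                       ≡⟨ left-comm x s (x ^↓ p) ⟩
  s * (x * x ^↓ p)                       ≡⟨ cong (s *_) (x*x^↓p≡x^↓[1+p]+p*x^↓p x p) ⟩
  s * (x ^↓ suc p + p * x ^↓ p)          ≡⟨ distrib s (x ^↓ suc p) p (x ^↓ p) ⟩
  s * x ^↓ suc p + p * (s * x ^↓ p)      ∎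
  where
  open ≡-Reasoning
  s = stirling₂ m p
  left-comm : ∀ a b c → a * (b * c) ≡ b * (a * c)
  left-comm = solve-∀
  distrib : ∀ a b c d → a * (b + c * d) ≡ a * b + c * (a * d)
  distrib = solve-∀

x^m≡∑stirling₂*x^↓ : ∀ m x K → x < K → fromℕ (x ^ m) ≡ sumℚ K (λ p → fromℕ (stirling₂ m p * x ^↓ p))
x^m≡∑stirling₂*x^↓ zero    x (suc K) _   =
  sym (trans (sumℚ-head K _) (trans (cong (1ℚ +ℚ_) (sumℚ-zero K)) (ℚ.+-identityʳ 1ℚ)))
x^m≡∑stirling₂*x^↓ (suc m) x (suc K) x<K = begin
  fromℕ (x * x ^ m)
    ≡⟨ fromℕ-homo-* x (x ^ m) ⟩
  fromℕ x *ℚ fromℕ (x ^ m)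
    ≡⟨ cong (fromℕ x *ℚ_) (x^m≡∑stirling₂*x^↓ m x (suc K) x<K) ⟩
  fromℕ x *ℚ sumℚ (suc K) (λ p → fromℕ (S p * x ^↓ p))
    ≡⟨ sumℚ-distribˡ-* (suc K) (fromℕ x) _ ⟩
  sumℚ (suc K) (λ p → fromℕ x *ℚ fromℕ (S p * x ^↓ p))
    ≡⟨ sumℚ-cong (suc K) split ⟩
  sumℚ (suc K) (λ p → fromℕ (S p * x ^↓ suc p) +ℚ fromℕ (p * (S p * x ^↓ p)))
    ≡⟨ sumℚ-distrib-+ (suc K) _ _ ⟩
  sumℚ (suc K) (λ p → fromℕ (S p * x ^↓ suc p)) +ℚ sumℚ (suc K) (λ p → fromℕ (p * (S p * x ^↓ p)))
    ≡⟨ cong₂ _+ℚ_ (sumℚ-init K (cong fromℕ last-vanishes)) (sumℚ-tail K refl) ⟩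
  sumℚ K (λ p → fromℕ (S p * x ^↓ suc p)) +ℚ sumℚ K (λ p → fromℕ (suc p * (S (suc p) * x ^↓ suc p)))
    ≡⟨ sumℚ-distrib-+ K _ _ ⟨
  sumℚ K (λ p → fromℕ (S p * x ^↓ suc p) +ℚ fromℕ (suc p * (S (suc p) * x ^↓ suc p)))
    ≡⟨ sumℚ-cong K merge ⟩
  sumℚ K (λ p → fromℕ (stirling₂ (suc m) (suc p) * x ^↓ suc p))
    ≡⟨ sumℚ-tail K refl ⟨
  sumℚ (suc K) (λ p → fromℕ (stirling₂ (suc m) p * x ^↓ p))
    ∎
  where
  open ≡-Reasoning
  S = stirling₂ m
  last-vanishes : S K * x ^↓ suc K ≡ 0
  last-vanishes = trans (cong (S K *_) (^↓-vanishes x<K)) (ℕ.*-zeroʳ (S K))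
  split : ∀ p → fromℕ x *ℚ fromℕ (S p * x ^↓ p) ≡ fromℕ (S p * x ^↓ suc p) +ℚ fromℕ (p * (S p * x ^↓ p))
  split p = trans (sym (fromℕ-homo-* x (S p * x ^↓ p)))
    (trans (cong fromℕ (stirling₂-step m x p)) (fromℕ-homo-+ (S p * x ^↓ suc p) (p * (S p * x ^↓ p))))
  merge : ∀ p → fromℕ (S p * x ^↓ suc p) +ℚ fromℕ (suc p * (S (suc p) * x ^↓ suc p))
              ≡ fromℕ (stirling₂ (suc m) (suc p) * x ^↓ suc p)
  merge p = trans (sym (fromℕ-homo-+ (S p * x ^↓ suc p) (suc p * (S (suc p) * x ^↓ suc p))))
    (cong fromℕ (rearrange (S p) (x ^↓ suc p) (suc p) (S (suc p))))
    where
    rearrange : ∀ s f q t → s * f + q * (t * f) ≡ (q * t + s) * f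
    rearrange = solve-∀

fromℕ-^↓-pascal : ∀ x p → fromℕ (suc x ^↓ suc p) ≡ fromℕ (x ^↓ suc p) +ℚ fromℕ (suc p) *ℚ fromℕ (x ^↓ p)
fromℕ-^↓-pascal x p = trans (cong fromℕ (^↓-pascal x p))
  (trans (fromℕ-homo-+ (x ^↓ suc p) (suc p * x ^↓ p)) (cong (fromℕ (x ^↓ suc p) +ℚ_) (fromℕ-homo-* (suc p) (x ^↓ p))))

H↓ : ℕ → ℕ → ℚ
H↓ n p = sumℚ n (λ i → fromℕ ((n ∸ suc i) ^↓ p) *ℚ 1 ⁄suc i)

H↓-pascal : ∀ n p → H↓ (suc n) (suc p) ≡ H↓ n (suc p) +ℚ fromℕ (suc p) *ℚ H↓ n p
H↓-pascal n p = begin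
  sumℚ (suc n) (λ i → fromℕ ((n ∸ i) ^↓ suc p) *ℚ 1 ⁄suc i)
    ≡⟨ sumℚ-init n (trans (cong (λ k → fromℕ (k ^↓ suc p) *ℚ 1 ⁄suc n) (ℕ.n∸n≡0 n)) (ℚ.*-zeroˡ (1 ⁄suc n))) ⟩
  sumℚ n (λ i → fromℕ ((n ∸ i) ^↓ suc p) *ℚ 1 ⁄suc i)
    ≡⟨ sumℚ-cong< n split ⟩
  sumℚ n (λ i → fromℕ ((n ∸ suc i) ^↓ suc p) *ℚ 1 ⁄suc i +ℚ c *ℚ (fromℕ ((n ∸ suc i) ^↓ p) *ℚ 1 ⁄suc i))
    ≡⟨ sumℚ-distrib-+ n _ _ ⟩
  H↓ n (suc p) +ℚ sumℚ n (λ i → c *ℚ (fromℕ ((n ∸ suc i) ^↓ p) *ℚ 1 ⁄suc i))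
    ≡⟨ cong (H↓ n (suc p) +ℚ_) (sumℚ-distribˡ-* n c _) ⟨
  H↓ n (suc p) +ℚ c *ℚ H↓ n p
    ∎
  where
  open ≡-Reasoning
  c = fromℕ (suc p)
  n∸i≡1+[n∸1+i] : ∀ {n i} → i < n → n ∸ i ≡ suc (n ∸ suc i)
  n∸i≡1+[n∸1+i] {suc n} {zero}  _         = refl
  n∸i≡1+[n∸1+i] {suc n} {suc i} (s≤s i<n) = n∸i≡1+[n∸1+i] i<n
  split : ∀ i → i < n → fromℕ ((n ∸ i) ^↓ suc p) *ℚ 1 ⁄suc i
                      ≡ fromℕ ((n ∸ suc i) ^↓ suc p) *ℚ 1 ⁄suc i +ℚ c *ℚ (fromℕ ((n ∸ suc i) ^↓ p) *ℚ 1 ⁄suc i)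
  split i i<n = begin
    fromℕ ((n ∸ i) ^↓ suc p) *ℚ u
      ≡⟨ cong (λ k → fromℕ (k ^↓ suc p) *ℚ u) (n∸i≡1+[n∸1+i] i<n) ⟩
    fromℕ (suc y ^↓ suc p) *ℚ u
      ≡⟨ cong (_*ℚ u) (fromℕ-^↓-pascal y p) ⟩
    (fromℕ (y ^↓ suc p) +ℚ c *ℚ fromℕ (y ^↓ p)) *ℚ u
      ≡⟨ distrib (fromℕ (y ^↓ suc p)) c (fromℕ (y ^↓ p)) u ⟩
    fromℕ (y ^↓ suc p) *ℚ u +ℚ c *ℚ (fromℕ (y ^↓ p) *ℚ u)
      ∎
    where
    y = n ∸ suc i
    u = 1 ⁄suc i
    distrib : ∀ a b d e → (a +ℚ b *ℚ d) *ℚ e ≡ a *ℚ e +ℚ b *ℚ (d *ℚ e)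
    distrib = +-*-Solver.solve 4 (λ a b d e → (a :+ b :* d) :* e := a :* e :+ b :* (d :* e)) refl
      where open +-*-Solver

^↓*[H-H]≡H↓ : ∀ n p → fromℕ (n ^↓ p) *ℚ (H n -ℚ H p) ≡ H↓ n p
^↓*[H-H]≡H↓ n       zero    = trans (cong (1ℚ *ℚ_) (ℚ.+-identityʳ (H n))) (sumℚ-distribˡ-* n 1ℚ _)
^↓*[H-H]≡H↓ zero    (suc p) = ℚ.*-zeroˡ (0ℚ -ℚ H (suc p))
^↓*[H-H]≡H↓ (suc n) (suc p) = begin
  X *ℚ ((h +ℚ u) -ℚ (k +ℚ v))
    ≡⟨ split X h u k v ⟩
  X *ℚ (h -ℚ (k +ℚ v)) +ℚ X *ℚ u
    ≡⟨ cong₂ (λ a b → a *ℚ (h -ℚ (k +ℚ v)) +ℚ b) (fromℕ-^↓-pascal n p) Xu≡cBv ⟩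
  (A +ℚ c *ℚ B) *ℚ (h -ℚ (k +ℚ v)) +ℚ c *ℚ B *ℚ v
    ≡⟨ regroup A c B h k v ⟩
  A *ℚ (h -ℚ (k +ℚ v)) +ℚ c *ℚ (B *ℚ (h -ℚ k))
    ≡⟨ cong₂ (λ a b → a +ℚ c *ℚ b) (^↓*[H-H]≡H↓ n (suc p)) (^↓*[H-H]≡H↓ n p) ⟩
  H↓ n (suc p) +ℚ c *ℚ H↓ n p
    ≡⟨ H↓-pascal n p ⟨
  H↓ (suc n) (suc p)
    ∎
  where
  open ≡-Reasoning
  open +-*-Solver using (solve; _:+_; _:-_; _:*_; _:=_)
  X = fromℕ (suc n ^↓ suc p)
  A = fromℕ (n ^↓ suc p)
  B = fromℕ (n ^↓ p)
  c = fromℕ (suc p)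
  h = H n
  k = H p
  u = 1 ⁄suc n
  v = 1 ⁄suc p
  Xu≡cBv : X *ℚ u ≡ c *ℚ B *ℚ v
  Xu≡cBv = begin
    X *ℚ u                        ≡⟨ cong (_*ℚ u) (fromℕ-homo-* (suc n) (n ^↓ p)) ⟩
    fromℕ (suc n) *ℚ B *ℚ u       ≡⟨ [1+b]*x*1⁄suc-b≡x n B ⟩
    B                             ≡⟨ [1+b]*x*1⁄suc-b≡x p B ⟨
    c *ℚ B *ℚ v                   ∎
  split : ∀ X h u k v → X *ℚ ((h +ℚ u) -ℚ (k +ℚ v)) ≡ X *ℚ (h -ℚ (k +ℚ v)) +ℚ X *ℚ u
  split = solve 5 (λ X h u k v → X :* ((h :+ u) :- (k :+ v)) := X :* (h :- (k :+ v)) :+ X :* u) refl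
  regroup : ∀ A c B h k v →
    (A +ℚ c *ℚ B) *ℚ (h -ℚ (k +ℚ v)) +ℚ c *ℚ B *ℚ v ≡ A *ℚ (h -ℚ (k +ℚ v)) +ℚ c *ℚ (B *ℚ (h -ℚ k))
  regroup = solve 6 (λ A c B h k v →
    (A :+ c :* B) :* (h :- (k :+ v)) :+ c :* B :* v := A :* (h :- (k :+ v)) :+ c :* (B :* (h :- k))) refl

∑∑a⁄suc≡∑a*H : ∀ n (a : ℕ → ℕ) →
  sumℚ n (λ i → sumℚ (suc i) (λ j → a j ⁄suc (i ∸ j))) ≡ sumℚ n (λ j → fromℕ (a j) *ℚ H (n ∸ j))
∑∑a⁄suc≡∑a*H n a = trans (sumℚ-triangle n (λ j t → a j ⁄suc t)) (sumℚ-cong n row)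
  where
  row : ∀ j → sumℚ (n ∸ j) (λ t → a j ⁄suc t) ≡ fromℕ (a j) *ℚ H (n ∸ j)
  row j = trans (sumℚ-cong (n ∸ j) (a⁄suc-b≡a*1⁄suc-b (a j))) (sym (sumℚ-distribˡ-* (n ∸ j) (fromℕ (a j)) _))

stirlingHarmonicSum : ℕ → ℕ → ℚ
stirlingHarmonicSum m n = sumℚ (suc n) (λ p → fromℕ (stirling₂ m p * n ^↓ p) *ℚ H p)

convolution≡stirlingHarmonicSum : ∀ m n →
  sumℚ n (λ i → sumℚ (suc i) (λ j → (((n ∸ j) ! * (n C j) * stirling₂ m (n ∸ j)) ⁄suc (i ∸ j))))
  ≡ stirlingHarmonicSum m n
convolution≡stirlingHarmonicSum m n = begin
  sumℚ n (λ i → sumℚ (suc i) (λ j → a j ⁄suc (i ∸ j)))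
    ≡⟨ ∑∑a⁄suc≡∑a*H n a ⟩
  sumℚ n (λ j → fromℕ (a j) *ℚ H (n ∸ j))
    ≡⟨ sumℚ-cong< n (λ j j<n → cong (λ b → fromℕ b *ℚ H (n ∸ j)) (a≡S*^↓ j (ℕ.<⇒≤ j<n))) ⟩
  sumℚ n (λ j → term (n ∸ j))
    ≡⟨ sumℚ-reverse n term ⟩
  sumℚ n (term ∘ suc)
    ≡⟨ sumℚ-tail n (ℚ.*-zeroʳ (fromℕ (stirling₂ m 0 * 1))) ⟨
  stirlingHarmonicSum m n
    ∎
  where
  open ≡-Reasoning
  a : ℕ → ℕ
  a j = (n ∸ j) ! * (n C j) * stirling₂ m (n ∸ j)
  term : ℕ → ℚ
  term p = fromℕ (stirling₂ m p * n ^↓ p) *ℚ H p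
  a≡S*^↓ : ∀ j → j ≤ n → a j ≡ stirling₂ m (n ∸ j) * n ^↓ (n ∸ j)
  a≡S*^↓ j j≤n = trans (cong (λ b → (n ∸ j) ! * b * stirling₂ m (n ∸ j)) (nCk≡nC[n∸k] j≤n))
    (trans (cong (_* stirling₂ m (n ∸ j)) (p!*nCp≡n^↓p n (n ∸ j))) (ℕ.*-comm (n ^↓ (n ∸ j)) _))

stirlingH↓Sum : ℕ → ℕ → ℚ
stirlingH↓Sum m n = sumℚ (suc n) (λ p → fromℕ (stirling₂ m p) *ℚ H↓ n p)

n^m*H≡stirlingHarmonicSum+stirlingH↓Sum : ∀ m n →
  fromℕ (n ^ m) *ℚ H n ≡ stirlingHarmonicSum m n +ℚ stirlingH↓Sum m n
n^m*H≡stirlingHarmonicSum+stirlingH↓Sum m n = begin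
  fromℕ (n ^ m) *ℚ H n
    ≡⟨ cong (_*ℚ H n) (x^m≡∑stirling₂*x^↓ m n (suc n) (ℕ.n<1+n n)) ⟩
  sumℚ (suc n) (λ p → fromℕ (S p * n ^↓ p)) *ℚ H n
    ≡⟨ sumℚ-distribʳ-* (suc n) (H n) _ ⟩
  sumℚ (suc n) (λ p → fromℕ (S p * n ^↓ p) *ℚ H n)
    ≡⟨ sumℚ-cong (suc n) split ⟩
  sumℚ (suc n) (λ p → fromℕ (S p * n ^↓ p) *ℚ H p +ℚ fromℕ (S p) *ℚ H↓ n p)
    ≡⟨ sumℚ-distrib-+ (suc n) _ _ ⟩
  stirlingHarmonicSum m n +ℚ stirlingH↓Sum m n
    ∎
  where
  open ≡-Reasoning
  S = stirling₂ m
  split : ∀ p → fromℕ (S p * n ^↓ p) *ℚ H n ≡ fromℕ (S p * n ^↓ p) *ℚ H p +ℚ fromℕ (S p) *ℚ H↓ n p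
  split p = begin
    fromℕ (S p * n ^↓ p) *ℚ H n
      ≡⟨ cong (_*ℚ H n) (fromℕ-homo-* (S p) (n ^↓ p)) ⟩
    fromℕ (S p) *ℚ fromℕ (n ^↓ p) *ℚ H n
      ≡⟨ distrib (fromℕ (S p)) (fromℕ (n ^↓ p)) (H n) (H p) ⟩
    fromℕ (S p) *ℚ fromℕ (n ^↓ p) *ℚ H p +ℚ fromℕ (S p) *ℚ (fromℕ (n ^↓ p) *ℚ (H n -ℚ H p))
      ≡⟨ cong₂ (λ a b → a *ℚ H p +ℚ fromℕ (S p) *ℚ b) (sym (fromℕ-homo-* (S p) (n ^↓ p))) (^↓*[H-H]≡H↓ n p) ⟩
    fromℕ (S p * n ^↓ p) *ℚ H p +ℚ fromℕ (S p) *ℚ H↓ n p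
      ∎
    where
    distrib : ∀ s f h k → s *ℚ f *ℚ h ≡ s *ℚ f *ℚ k +ℚ s *ℚ (f *ℚ (h -ℚ k))
    distrib = +-*-Solver.solve 4 (λ s f h k → s :* f :* h := s :* f :* k :+ s :* (f :* (h :- k))) refl
      where open +-*-Solver

∑[n∸1+i]^m⁄suc≡stirlingH↓Sum : ∀ m n → sumℚ n (λ i → ((n ∸ suc i) ^ m) ⁄suc i) ≡ stirlingH↓Sum m n
∑[n∸1+i]^m⁄suc≡stirlingH↓Sum m n = begin
  sumℚ n (λ i → ((n ∸ suc i) ^ m) ⁄suc i)
    ≡⟨ sumℚ-cong n expand ⟩
  sumℚ n (λ i → sumℚ (suc n) (λ p → fromℕ (S p) *ℚ (fromℕ ((n ∸ suc i) ^↓ p) *ℚ 1 ⁄suc i)))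
    ≡⟨ sumℚ-comm n (suc n) _ ⟩
  sumℚ (suc n) (λ p → sumℚ n (λ i → fromℕ (S p) *ℚ (fromℕ ((n ∸ suc i) ^↓ p) *ℚ 1 ⁄suc i)))
    ≡⟨ sumℚ-cong (suc n) (λ p → sym (sumℚ-distribˡ-* n (fromℕ (S p)) _)) ⟩
  stirlingH↓Sum m n
    ∎
  where
  open ≡-Reasoning
  S = stirling₂ m
  expand : ∀ i → ((n ∸ suc i) ^ m) ⁄suc i
               ≡ sumℚ (suc n) (λ p → fromℕ (S p) *ℚ (fromℕ ((n ∸ suc i) ^↓ p) *ℚ 1 ⁄suc i))
  expand i = begin
    (y ^ m) ⁄suc i
      ≡⟨ a⁄suc-b≡a*1⁄suc-b (y ^ m) i ⟩
    fromℕ (y ^ m) *ℚ 1 ⁄suc i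
      ≡⟨ cong (_*ℚ 1 ⁄suc i) (x^m≡∑stirling₂*x^↓ m y (suc n) (s≤s (ℕ.m∸n≤m n (suc i)))) ⟩
    sumℚ (suc n) (λ p → fromℕ (S p * y ^↓ p)) *ℚ 1 ⁄suc i
      ≡⟨ sumℚ-distribʳ-* (suc n) (1 ⁄suc i) _ ⟩
    sumℚ (suc n) (λ p → fromℕ (S p * y ^↓ p) *ℚ 1 ⁄suc i)
      ≡⟨ sumℚ-cong (suc n) (λ p → trans (cong (_*ℚ 1 ⁄suc i) (fromℕ-homo-* (S p) (y ^↓ p)))
                                         (ℚ.*-assoc (fromℕ (S p)) (fromℕ (y ^↓ p)) (1 ⁄suc i))) ⟩
    sumℚ (suc n) (λ p → fromℕ (S p) *ℚ (fromℕ (y ^↓ p) *ℚ 1 ⁄suc i))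
      ∎
    where y = n ∸ suc i

proposition16 : (m n : ℕ) →
    sumℚ n (λ i → sumℚ (suc i) (λ j →
      (((n ∸ j) ! * (n C j) * stirling₂ m (n ∸ j)) ⁄suc (i ∸ j))))
    ≡ ((+ (n ^ m)) / 1) *ℚ H n -ℚ sumℚ n (λ i → ((n ∸ suc i) ^ m) ⁄suc i)
proposition16 m n = begin
  sumℚ n (λ i → sumℚ (suc i) (λ j → (((n ∸ j) ! * (n C j) * stirling₂ m (n ∸ j)) ⁄suc (i ∸ j))))
    ≡⟨ convolution≡stirlingHarmonicSum m n ⟩
  stirlingHarmonicSum m n
    ≡⟨ //-rightDividesʳ (stirlingH↓Sum m n) (stirlingHarmonicSum m n) ⟨
  stirlingHarmonicSum m n +ℚ stirlingH↓Sum m n -ℚ stirlingH↓Sum m n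
    ≡⟨ cong₂ _-ℚ_ (n^m*H≡stirlingHarmonicSum+stirlingH↓Sum m n) (∑[n∸1+i]^m⁄suc≡stirlingH↓Sum m n) ⟨
  fromℕ (n ^ m) *ℚ H n -ℚ sumℚ n (λ i → ((n ∸ suc i) ^ m) ⁄suc i)
    ∎
  where open ≡-Reasoning
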